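{- For every integer $n\ge1$, $\mathrm{pk}_n(123,132,213)=\frac23\,2^n+\frac13(-1)^n$.
   Context: For a positive integer $n$, $[n]=\{1,\dots,n\}$. A function $f:[n]\to[n]$ is a parking function if for every $i\in[n]$, $|\{j\in[n]: f(j)\le i\}|\ge i$ (equivalently, in the usual car-parking process where car $i$ prefers spot $f(i)$ and takes the first free spot at or after it, all cars park). The parking permutation $\rho_f\in S_n$ is defined by: spot $i$ is occupied by car $\rho_f(i)$. A permutation $\pi\in S_n$ contains $\sigma\in S_m$ as a pattern if there exist $1\le i_1<\dots<i_m\le n$ with $\pi(i_a)<\pi(i_b)$ iff $\sigma(a)<\sigma(b)$ for all $a,b$; otherwise it avoids $\sigma$. $\mathrm{pk}_n(\sigma_1,\dots,\sigma_k)$ is the number of parking functions $f:[n]\to[n]$ with $\rho_f$ avoiding every $\sigma_i$. -}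

module Defs where

open import Data.Nat using (ℕ; zero; suc; _<ᵇ_; _≤ᵇ_)
open import Data.Bool using (Bool; true; false; _∧_; _∨_; not; if_then_else_)
open import Data.Fin using (Fin; toℕ)
open import Data.Fin.Properties using (_≟_)
open import Data.List using (List; []; _∷_; length; map; concatMap; allFin; _++_)
open import Data.Vec as V using (Vec; []; _∷_; lookup; updateAt; replicate; toList)
open import Data.Maybe using (Maybe; just; nothing; is-nothing)
open import Relation.Nullary.Decidable using (⌊_⌋)

-- Conventions: [n] is represented by Fin n (0-indexed: element k stands for k+1).
-- A function f : [n] → [n] is a vector  Vec (Fin n) n  (f i = lookup f i).
-- A permutation in S_m is given in one-line notation as Vec (Fin m) m.

boolFilter : {A : Set} → (A → Bool) → List A → List A
boolFilter p []       = []
boolFilter p (x ∷ xs) = if p x then x ∷ boolFilter p xs else boolFilter p xs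

all : {A : Set} → (A → Bool) → List A → Bool
all p []       = true
all p (x ∷ xs) = p x ∧ all p xs

any : {A : Set} → (A → Bool) → List A → Bool
any p []       = false
any p (x ∷ xs) = p x ∨ any p xs

allVecs : {A : Set} → (k : ℕ) → List A → List (Vec A k)
allVecs zero    xs = [] ∷ []
allVecs (suc k) xs = concatMap (λ x → map (x ∷_) (allVecs k xs)) xs

allFunctions : (n : ℕ) → List (Vec (Fin n) n)
allFunctions n = allVecs n (allFin n)

-- Parking function: for every i ∈ [n], |{ j : f(j) ≤ i }| ≥ i.
-- (0-indexed: for every i : Fin n, |{ j : toℕ (f j) ≤ toℕ i }| ≥ toℕ i + 1.)
isParkingFunction : {n : ℕ} → Vec (Fin n) n → Bool
isParkingFunction {n} f =
  all (λ i → suc (toℕ i) ≤ᵇ length (boolFilter (λ j → toℕ (lookup f j) ≤ᵇ toℕ i) (allFin n)))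
      (allFin n)

-- Parking process.  Occupancy: spot k holds  just c  if car c parked there.
Occupancy : ℕ → Set
Occupancy n = Vec (Maybe (Fin n)) n

firstFreeFrom : {n : ℕ} → Occupancy n → Fin n → Maybe (Fin n)
firstFreeFrom {n} occ s = go (allFin n)
  where
  go : List (Fin n) → Maybe (Fin n)
  go []       = nothing
  go (k ∷ ks) = if (toℕ s ≤ᵇ toℕ k) ∧ is-nothing (lookup occ k) then just k else go ks

runParking : {n : ℕ} → Vec (Fin n) n → List (Fin n) → Occupancy n → Maybe (Occupancy n)
runParking f []       occ = just occ
runParking f (c ∷ cs) occ with firstFreeFrom occ (lookup f c)
... | nothing = nothing
... | just k  = runParking f cs (updateAt occ k (λ _ → just c))

allJust : {A : Set} {k : ℕ} → Vec (Maybe A) k → Maybe (Vec A k)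
allJust []             = just []
allJust (nothing ∷ xs) = nothing
allJust (just x ∷ xs) with allJust xs
... | nothing = nothing
... | just ys = just (x ∷ ys)

-- Parking permutation ρ_f : spot i is occupied by car ρ_f(i)  (nothing if not all cars park).
parkingPermutation : {n : ℕ} → Vec (Fin n) n → Maybe (Vec (Fin n) n)
parkingPermutation {n} f with runParking f (allFin n) (replicate n nothing)
... | nothing  = nothing
... | just occ = allJust occ

subseqs : {A : Set} → (m : ℕ) → List A → List (Vec A m)
subseqs zero    xs       = [] ∷ []
subseqs (suc m) []       = []
subseqs (suc m) (x ∷ xs) = map (x ∷_) (subseqs m xs) ++ subseqs (suc m) xs

orderIso : {n m : ℕ} → Vec (Fin n) m → Vec (Fin m) m → Bool
orderIso {n} {m} w σ =
  all (λ a → all (λ b → eqB (toℕ (lookup w a) <ᵇ toℕ (lookup w b))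
                            (toℕ (lookup σ a) <ᵇ toℕ (lookup σ b)))
                 (allFin m))
      (allFin m)
  where
  eqB : Bool → Bool → Bool
  eqB true  y = y
  eqB false y = not y

contains : {n m : ℕ} → Vec (Fin n) n → Vec (Fin m) m → Bool
contains {n} {m} π σ = any (λ w → orderIso w σ) (subseqs m (toList π))

avoids : {n m : ℕ} → Vec (Fin n) n → Vec (Fin m) m → Bool
avoids π σ = not (contains π σ)

avoidsAll : {n m : ℕ} → Vec (Fin n) n → List (Vec (Fin m) m) → Bool
avoidsAll π σs = all (avoids π) σs

-- ρ_f avoids every pattern (false if ρ_f is undefined, which never happens for parking functions).
parkPermAvoids : {n m : ℕ} → Vec (Fin n) n → List (Vec (Fin m) m) → Bool
parkPermAvoids f σs with parkingPermutation f
... | nothing = false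
... | just ρ  = avoidsAll ρ σs

pk : (n : ℕ) {m : ℕ} → List (Vec (Fin m) m) → ℕ
pk n σs = length (boolFilter (λ f → isParkingFunction f ∧ parkPermAvoids f σs) (allFunctions n))

p123 p132 p213 : Vec (Fin 3) 3
p123 = Fin.zero ∷ Fin.suc Fin.zero ∷ Fin.suc (Fin.suc Fin.zero) ∷ []
  where import Data.Fin as Fin
p132 = Fin.zero ∷ Fin.suc (Fin.suc Fin.zero) ∷ Fin.suc Fin.zero ∷ []
  where import Data.Fin as Fin
p213 = Fin.suc Fin.zero ∷ Fin.zero ∷ Fin.suc (Fin.suc Fin.zero) ∷ []
  where import Data.Fin as Fin

{-# OPTIONS --safe #-}
module Submission where

-- Avoiding 123, 132 and 213 means that every entry of ρ_f exceeds all entries at least two places to its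
-- right. As the cars arrive in increasing order, this happens exactly when the free spots are filled from
-- the right, either by one car preferring the rightmost free spot or by two cars, the first preferring the
-- second-rightmost free spot and the second either of the two. Any other choice makes a car fail to park,
-- or leaves a car to the left of two larger ones (123 or 132) or of a smaller and then a larger one (213).
-- Such preference sequences are automatically parking functions, and counting them gives
-- a(m) = a(m-1) + 2 a(m-2), the Jacobsthal recursion, whence 3 pk_n = 2^(n+1) + (-1)^n.

open import Data.List using (_∷_; [])
open import Data.Nat using (ℕ; suc; _≥_)
open import Relation.Binary.PropositionalEquality

open import Defs

-- A module of its own keeps ℕ arithmetic apart from the integer operators of the statement.
module Enumeration where

  open import Data.Bool using (Bool; true; false; _∧_; _∨_; not; if_then_else_)
  open import Data.Bool.Properties using (∧-zeroʳ; ∨-zeroʳ; ∨-assoc; ∧-distribʳ-∨; ¬-not; ⇔→≡)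
  open import Data.Empty using (⊥; ⊥-elim)
  open import Data.Fin as F using (Fin; toℕ; fromℕ<)
  open import Data.Fin.Properties as FP using (toℕ-injective; toℕ<n; toℕ-fromℕ<)
  open import Data.List using (List; _++_; length; map; concatMap; tabulate; allFin; findᵇ)
  open import Data.List.Properties using (length-++; length-tabulate; map-tabulate; map-cong)
  open import Data.List.Membership.Propositional using (_∈_)
  open import Data.List.Membership.Propositional.Properties using (∈-allFin)
  open import Data.List.Relation.Unary.Any using (here; there)
  open import Data.List.Relation.Unary.All as All using (All; []; _∷_)
  open import Data.List.Relation.Unary.All.Properties using (++⁻ˡ; ++⁻ʳ)
  open import Data.List.Relation.Unary.AllPairs as AllPairs using (AllPairs; []; _∷_)
  open import Data.List.Relation.Unary.AllPairs.Properties using (tabulate⁺-<)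
  open import Data.List.Relation.Unary.Unique.Propositional using (Unique)
  open import Data.List.Relation.Binary.Sublist.Propositional as Sublist using (_⊆_; []; _∷_; _∷ʳ_; minimum)
  open import Data.List.Relation.Binary.Sublist.Propositional.Properties using (∷⁻)
  open import Data.Maybe using (Maybe; just; nothing; is-nothing; maybe)
  open import Data.Maybe.Properties using (just-injective)
  open import Data.Nat using (zero; _+_; _*_; _≤_; _<_; _⊓_; z≤n; s≤s; z<s; _≤ᵇ_; _<ᵇ_; _≡ᵇ_; _≟_; _≤?_; _<?_)
  open import Data.Nat.ListAction using (sum)
  open import Data.Nat.Properties
  open import Data.Product using (_×_; _,_; ∃-syntax; proj₁; proj₂)
  open import Data.Sum as Sum using (_⊎_; inj₁; inj₂)
  open import Data.Unit using (⊤; tt)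
  open import Data.Vec as V using (Vec; []; _∷_; lookup; toList; replicate; _[_]≔_)
  open import Data.Vec.Properties using (lookup∘update; lookup∘update′; lookup-replicate)
  open import Function using (_∘_; mk⇔)
  open import Relation.Binary.Definitions using (tri<; tri≈; tri>)
  open import Relation.Nullary using (¬_; contradiction; yes; no)
  open import Relation.Nullary.Reflects using (Reflects; ofʸ; ofⁿ; fromEquivalence)

  private
    variable
      A B P : Set
      b : Bool

  reflects-true : Reflects P b → P → b ≡ true
  reflects-true (ofʸ _)  _ = refl
  reflects-true (ofⁿ ¬p) p = contradiction p ¬p

  reflects-false : Reflects P b → ¬ P → b ≡ false
  reflects-false (ofʸ p) ¬p = contradiction p ¬p
  reflects-false (ofⁿ _) _  = refl

  reflects-sound : Reflects P b → b ≡ true → P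
  reflects-sound (ofʸ p) _ = p

  ≡ᵇ-reflects-≡ : ∀ m n → Reflects (m ≡ n) (m ≡ᵇ n)
  ≡ᵇ-reflects-≡ m n = fromEquivalence (≡ᵇ⇒≡ m n) (≡⇒≡ᵇ m n)

  ≡ᵇ-refl : ∀ m → (m ≡ᵇ m) ≡ true
  ≡ᵇ-refl m = reflects-true (≡ᵇ-reflects-≡ m m) refl

  ≡ᵇ-sound : ∀ {m n} → (m ≡ᵇ n) ≡ true → m ≡ n
  ≡ᵇ-sound = reflects-sound (≡ᵇ-reflects-≡ _ _)

  <ᵇ-true : ∀ {m n} → m < n → (m <ᵇ n) ≡ true
  <ᵇ-true = reflects-true (<ᵇ-reflects-< _ _)

  <ᵇ-false : ∀ m n → n ≤ m → (m <ᵇ n) ≡ false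
  <ᵇ-false m n n≤m = reflects-false (<ᵇ-reflects-< m n) (≤⇒≯ n≤m)

  <ᵇ-sound : ∀ {m n} → (m <ᵇ n) ≡ true → m < n
  <ᵇ-sound = reflects-sound (<ᵇ-reflects-< _ _)

  ≤ᵇ-true : ∀ {m n} → m ≤ n → (m ≤ᵇ n) ≡ true
  ≤ᵇ-true = reflects-true (≤ᵇ-reflects-≤ _ _)

  ≤ᵇ-sound : ∀ {m n} → (m ≤ᵇ n) ≡ true → m ≤ n
  ≤ᵇ-sound = reflects-sound (≤ᵇ-reflects-≤ _ _)

  ∨-true : ∀ {x y} → x ∨ y ≡ true → x ≡ true ⊎ y ≡ true
  ∨-true {true}  _ = inj₁ refl
  ∨-true {false} e = inj₂ e

  ∧-true : ∀ {x y} → x ∧ y ≡ true → x ≡ true × y ≡ true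
  ∧-true {true} e = refl , e

  both-false : ∀ {r a} → r ≡ false → (a ≡ true → ⊥) → r ≡ a
  both-false r≡false ¬a = trans r≡false (sym (¬-not ¬a))

  all-∈ : ∀ (p : A → Bool) {xs x} → all p xs ≡ true → x ∈ xs → p x ≡ true
  all-∈ p {x ∷ xs} e (here refl) = proj₁ (∧-true e)
  all-∈ p {x ∷ xs} e (there y∈)  = all-∈ p (proj₂ (∧-true {p x} e)) y∈

  all-true : ∀ (p : A → Bool) xs → (∀ {x} → x ∈ xs → p x ≡ true) → all p xs ≡ true
  all-true p []       _     = refl
  all-true p (x ∷ xs) all-p rewrite all-p (here refl) = all-true p xs (all-p ∘ there)

  all-false : ∀ (p : A → Bool) {xs x} → x ∈ xs → p x ≡ false → all p xs ≡ false
  all-false p         (here refl) px rewrite px = refl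
  all-false p {y ∷ _} (there x∈)  px rewrite all-false p x∈ px = ∧-zeroʳ (p y)

  any-++ : ∀ (g : A → Bool) xs ys → any g (xs ++ ys) ≡ any g xs ∨ any g ys
  any-++ g []       ys = refl
  any-++ g (x ∷ xs) ys rewrite any-++ g xs ys = sym (∨-assoc (g x) _ _)

  any-map : ∀ (g : B → Bool) (h : A → B) xs → any g (map h xs) ≡ any (g ∘ h) xs
  any-map g h []       = refl
  any-map g h (x ∷ xs) = cong (g (h x) ∨_) (any-map g h xs)

  AllPairs-++⁻ʳ : ∀ {R : A → A → Set} xs {ys} → AllPairs R (xs ++ ys) → AllPairs R ys
  AllPairs-++⁻ʳ []       rs       = rs
  AllPairs-++⁻ʳ (x ∷ xs) (_ ∷ rs) = AllPairs-++⁻ʳ xs rs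

  AllPairs-++-∈ : ∀ {R : A → A → Set} {xs ys x} → x ∈ xs → AllPairs R (xs ++ ys) → All (R x) ys
  AllPairs-++-∈ {xs = _ ∷ xs} (here refl) (r ∷ _)  = ++⁻ʳ xs r
  AllPairs-++-∈               (there x∈)  (_ ∷ rs) = AllPairs-++-∈ x∈ rs

  ascending⇒unique : ∀ {n} {cs : List (Fin n)} → AllPairs F._<_ cs → Unique cs
  ascending⇒unique = AllPairs.map FP.<⇒≢

  allJust-lookup : ∀ {k} (xs : Vec (Maybe A) k) {ys} → allJust xs ≡ just ys → ∀ i → lookup xs i ≡ just (lookup ys i)
  allJust-lookup (just x ∷ xs) e i with allJust xs in e′
  allJust-lookup (just x ∷ xs) refl F.zero    | just ys = refl
  allJust-lookup (just x ∷ xs) refl (F.suc i) | just ys = allJust-lookup xs e′ i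

  allJust-complete : ∀ {k} (xs : Vec (Maybe A) k) → (∀ i → ∃[ y ] lookup xs i ≡ just y) → ∃[ ys ] allJust xs ≡ just ys
  allJust-complete []       _    = [] , refl
  allJust-complete (x ∷ xs) full with full F.zero | allJust-complete xs (full ∘ F.suc)
  ... | y , refl | ys , e rewrite e = y ∷ ys , refl

  free≢parked : ∀ {x : Maybe A} {d} → x ≡ nothing → x ≡ just d → ⊥
  free≢parked refl ()

  trisect : ∀ {a b} x → x < a ⊎ (a ≤ x × x < b) ⊎ b ≤ x
  trisect {a} {b} x with x <? a | x <? b
  ... | yes x<a | _       = inj₁ x<a
  ... | no x≮a  | yes x<b = inj₂ (inj₁ (≮⇒≥ x≮a , x<b))
  ... | no _    | no x≮b  = inj₂ (inj₂ (≮⇒≥ x≮b))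

  m≤n<2+m⇒n≡m⊎n≡1+m : ∀ {m n} → m ≤ n → n < 2 + m → n ≡ m ⊎ n ≡ suc m
  m≤n<2+m⇒n≡m⊎n≡1+m {m} {n} m≤n n<2+m with n ≟ m
  ... | yes n≡m = inj₁ n≡m
  ... | no n≢m  = inj₂ (≤-antisym (≤-pred n<2+m) (≤∧≢⇒< m≤n (≢-sym n≢m)))

  ≢-outside : ∀ {a b x y} → a ≤ y → y < b → x < a ⊎ b ≤ x → x ≢ y
  ≢-outside a≤y _   (inj₁ x<a) refl = <⇒≱ x<a a≤y
  ≢-outside _   y<b (inj₂ b≤x) refl = <⇒≱ y<b b≤x

  -- Counting

  count : (A → Bool) → List A → ℕ
  count p xs = length (boolFilter p xs)

  count-∷-≤ : ∀ (p : A → Bool) x xs → count p xs ≤ count p (x ∷ xs)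
  count-∷-≤ p x xs with p x
  ... | true  = n≤1+n _
  ... | false = ≤-refl

  count-cong : ∀ {p q : A → Bool} → (∀ x → p x ≡ q x) → ∀ xs → count p xs ≡ count q xs
  count-cong p≗q []       = refl
  count-cong {q = q} p≗q (x ∷ xs) rewrite p≗q x with q x
  ... | true  = cong suc (count-cong p≗q xs)
  ... | false = count-cong p≗q xs

  count-++ : ∀ (p : A → Bool) xs ys → count p (xs ++ ys) ≡ count p xs + count p ys
  count-++ p []       ys = refl
  count-++ p (x ∷ xs) ys with p x
  ... | true  = cong suc (count-++ p xs ys)
  ... | false = count-++ p xs ys

  count-map : ∀ (p : B → Bool) (g : A → B) xs → count p (map g xs) ≡ count (p ∘ g) xs
  count-map p g []       = refl
  count-map p g (x ∷ xs) with p (g x)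
  ... | true  = cong suc (count-map p g xs)
  ... | false = count-map p g xs

  count-concatMap : ∀ (p : B → Bool) (h : A → List B) xs → count p (concatMap h xs) ≡ sum (map (count p ∘ h) xs)
  count-concatMap p h []       = refl
  count-concatMap p h (x ∷ xs) =
    trans (count-++ p (h x) (concatMap h xs)) (cong (count p (h x) +_) (count-concatMap p h xs))

  count-∨ : ∀ (p q : A → Bool) → (∀ x → p x ∧ q x ≡ false) → ∀ xs →
    count (λ x → p x ∨ q x) xs ≡ count p xs + count q xs
  count-∨ p q disjoint []       = refl
  count-∨ p q disjoint (x ∷ xs) with p x in px | q x in qx
  ... | true  | true  = contradiction (trans (sym (cong₂ _∧_ px qx)) (disjoint x)) λ ()
  ... | true  | false = cong suc (count-∨ p q disjoint xs)
  ... | false | true  = trans (cong suc (count-∨ p q disjoint xs)) (sym (+-suc _ _))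
  ... | false | false = count-∨ p q disjoint xs

  count-false : ∀ (xs : List A) → count (λ _ → false) xs ≡ 0
  count-false []       = refl
  count-false (x ∷ xs) = count-false xs

  count-∧ˡ : ∀ b (q : A → Bool) xs → count (λ x → b ∧ q x) xs ≡ (if b then count q xs else 0)
  count-∧ˡ true  q xs = refl
  count-∧ˡ false q xs = count-false xs

  sum-map-cong : ∀ {g h : A → ℕ} → (∀ x → g x ≡ h x) → ∀ xs → sum (map g xs) ≡ sum (map h xs)
  sum-map-cong g≗h xs = cong sum (map-cong g≗h xs)

  sum-tabulate-0 : ∀ N → sum (tabulate {n = N} (λ _ → 0)) ≡ 0
  sum-tabulate-0 zero    = refl
  sum-tabulate-0 (suc N) = sum-tabulate-0 N

  sum-indicator : ∀ {N} j c → j < N → sum (map (λ (x : Fin N) → if toℕ x ≡ᵇ j then c else 0) (allFin N)) ≡ c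
  sum-indicator {N} j c j<N = trans (cong sum (map-tabulate {n = N} (λ x → x) _)) (indicator j j<N)
    where
    indicator : ∀ {N} j → j < N → sum (tabulate {n = N} (λ x → if toℕ x ≡ᵇ j then c else 0)) ≡ c
    indicator {suc N} zero    _         = trans (cong (c +_) (sum-tabulate-0 N)) (+-identityʳ c)
    indicator {suc N} (suc j) (s≤s j<N) = indicator j j<N

  count-allVecs : ∀ {k} (P : Vec A (suc k) → Bool) xs →
    count P (allVecs (suc k) xs) ≡ sum (map (λ x → count (P ∘ (x ∷_)) (allVecs k xs)) xs)
  count-allVecs {k = k} P xs =
    trans (count-concatMap P (λ x → map (x ∷_) (allVecs k xs)) xs)
          (sum-map-cong (λ x → count-map P (x ∷_) (allVecs k xs)) xs)

  count-head : ∀ {N k} j (Q : Vec (Fin N) k → Bool) → j < N →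
    count (λ v → (toℕ (V.head v) ≡ᵇ j) ∧ Q (V.tail v)) (allVecs (suc k) (allFin N)) ≡ count Q (allVecs k (allFin N))
  count-head {N} {k} j Q j<N = begin
    count (λ v → (toℕ (V.head v) ≡ᵇ j) ∧ Q (V.tail v)) (allVecs (suc k) (allFin N))
      ≡⟨ count-allVecs _ (allFin N) ⟩
    sum (map (λ x → count (λ v → (toℕ x ≡ᵇ j) ∧ Q v) (allVecs k (allFin N))) (allFin N))
      ≡⟨ sum-map-cong (λ x → count-∧ˡ (toℕ x ≡ᵇ j) Q (allVecs k (allFin N))) (allFin N) ⟩
    sum (map (λ x → if toℕ x ≡ᵇ j then count Q (allVecs k (allFin N)) else 0) (allFin N))
      ≡⟨ sum-indicator j _ j<N ⟩
    count Q (allVecs k (allFin N)) ∎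
    where open ≡-Reasoning

  -- The parking process

  findᵇ-unique : ∀ {p : A → Bool} {F : List A → Maybe A} → F [] ≡ nothing →
    (∀ x xs → F (x ∷ xs) ≡ (if p x then just x else F xs)) → ∀ xs → F xs ≡ findᵇ p xs
  findᵇ-unique         F[] F∷ []       = F[]
  findᵇ-unique {p = p} F[] F∷ (x ∷ xs) rewrite F∷ x xs | findᵇ-unique {p = p} F[] F∷ xs = refl

  findᵇ-sound : ∀ (p : A → Bool) xs {y} → findᵇ p xs ≡ just y → p y ≡ true
  findᵇ-sound p (x ∷ xs) e with p x in px
  findᵇ-sound p (x ∷ xs) refl | true = px
  ... | false = findᵇ-sound p xs e

  findᵇ-none : ∀ (p : A → Bool) → (∀ x → p x ≡ false) → ∀ xs → findᵇ p xs ≡ nothing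
  findᵇ-none p none []       = refl
  findᵇ-none p none (x ∷ xs) rewrite none x = findᵇ-none p none xs

  findᵇ-tabulate : ∀ {k} (p : A → Bool) (g : Fin k → A) i → p (g i) ≡ true →
    (∀ j → j F.< i → p (g j) ≡ false) → findᵇ p (tabulate g) ≡ just (g i)
  findᵇ-tabulate p g F.zero    pgi _      rewrite pgi = refl
  findᵇ-tabulate p g (F.suc i) pgi before rewrite before F.zero (s≤s z≤n) =
    findᵇ-tabulate p (g ∘ F.suc) i pgi (λ j j<i → before (F.suc j) (s≤s j<i))

  Occupied : ∀ {n} → Occupancy n → Fin n → Set
  Occupied occ k = ∃[ c ] lookup occ k ≡ just c

  isFreeFrom : ∀ {n} → Occupancy n → Fin n → Fin n → Bool
  isFreeFrom occ s k = (toℕ s ≤ᵇ toℕ k) ∧ is-nothing (lookup occ k)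

  lookup-elsewhere : ∀ {n} (occ : Occupancy n) {s k} x → toℕ s ≢ toℕ k → lookup (occ [ k ]≔ x) s ≡ lookup occ s
  lookup-elsewhere occ x s≢k = lookup∘update′ (s≢k ∘ cong toℕ) occ x

  module _ {n} (occ : Occupancy n) (s : Fin n) where

    -- firstFreeFrom scans allFin n with a local function; abstracting allFin n lets unification name it.
    firstFreeFrom≡findᵇ : firstFreeFrom occ s ≡ findᵇ (isFreeFrom occ s) (allFin n)
    firstFreeFrom≡findᵇ with allFin n | findᵇ-unique {p = isFreeFrom occ s} refl (λ _ _ → refl)
    ... | ks | unique = unique ks

    firstFreeFrom-free : ∀ {k} → firstFreeFrom occ s ≡ just k → lookup occ k ≡ nothing
    firstFreeFrom-free {k} e with lookup occ k | findᵇ-sound _ (allFin n) (trans (sym firstFreeFrom≡findᵇ) e)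
    ... | nothing | _ = refl
    ... | just _  | isFree = contradiction (proj₂ (∧-true {toℕ s ≤ᵇ toℕ k} isFree)) λ ()

    firstFreeFrom-nothing : (∀ k → s F.≤ k → Occupied occ k) → firstFreeFrom occ s ≡ nothing
    firstFreeFrom-nothing full = trans firstFreeFrom≡findᵇ (findᵇ-none _ notFree (allFin n))
      where
      notFree : ∀ k → isFreeFrom occ s k ≡ false
      notFree k with toℕ s ≤ᵇ toℕ k in s≤k
      ... | false = refl
      ... | true  = cong is-nothing (proj₂ (full k (≤ᵇ-sound s≤k)))

    firstFreeFrom-just : ∀ {k} → s F.≤ k → lookup occ k ≡ nothing → (∀ j → s F.≤ j → j F.< k → Occupied occ j) →
      firstFreeFrom occ s ≡ just k
    firstFreeFrom-just {k} s≤k free between =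
      trans firstFreeFrom≡findᵇ (findᵇ-tabulate _ (λ j → j) k freeAt notFree)
      where
      freeAt : isFreeFrom occ s k ≡ true
      freeAt rewrite ≤ᵇ-true s≤k | free = refl
      notFree : ∀ j → j F.< k → isFreeFrom occ s j ≡ false
      notFree j j<k with toℕ s ≤ᵇ toℕ j in s≤j
      ... | false = refl
      ... | true  = cong is-nothing (proj₂ (between j (≤ᵇ-sound s≤j) j<k))

    firstFreeFrom-self : lookup occ s ≡ nothing → firstFreeFrom occ s ≡ just s
    firstFreeFrom-self free = firstFreeFrom-just ≤-refl free (λ j s≤j j<s → ⊥-elim (<-irrefl refl (≤-<-trans s≤j j<s)))

  module _ {n} (f : Vec (Fin n) n) where

    run-step : ∀ c cs occ {k} → firstFreeFrom occ (lookup f c) ≡ just k →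
      runParking f (c ∷ cs) occ ≡ runParking f cs (occ [ k ]≔ just c)
    run-step c cs occ e with firstFreeFrom occ (lookup f c)
    run-step c cs occ refl | just k = refl

    run-stuck : ∀ c cs occ → firstFreeFrom occ (lookup f c) ≡ nothing → runParking f (c ∷ cs) occ ≡ nothing
    run-stuck c cs occ e with firstFreeFrom occ (lookup f c)
    run-stuck c cs occ refl | nothing = refl

    run-keeps : ∀ cs {occ occF s d} → lookup occ s ≡ just d → runParking f cs occ ≡ just occF → lookup occF s ≡ just d
    run-keeps []       occ-s refl = occ-s
    run-keeps (c ∷ cs) {occ} {s = s} occ-s run with firstFreeFrom occ (lookup f c) in ff
    ... | just k = run-keeps cs (trans (lookup∘update′ s≢k occ (just c)) occ-s) run
      where
      s≢k : s ≢ k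
      s≢k refl = free≢parked (firstFreeFrom-free occ _ ff) occ-s

    run-fills : ∀ cs {occ occF s d} → lookup occ s ≡ nothing → runParking f cs occ ≡ just occF →
      lookup occF s ≡ just d → d ∈ cs
    run-fills []       free refl occF-s = ⊥-elim (free≢parked free occF-s)
    run-fills (c ∷ cs) {occ} {s = s} free run occF-s with firstFreeFrom occ (lookup f c)
    ... | just k with s F.≟ k
    ...   | yes refl = here (just-injective (trans (sym occF-s) (run-keeps cs (lookup∘update s occ (just c)) run)))
    ...   | no s≢k   = there (run-fills cs (trans (lookup∘update′ s≢k occ (just c)) free) run occF-s)

    run-parks-once : ∀ c cs {occ occF k u d} → All (c ≢_) cs → u ≢ k → lookup occ u ≡ nothing →
      runParking f cs (occ [ k ]≔ just c) ≡ just occF → lookup occF k ≡ just d → lookup occF u ≡ just d → ⊥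
    run-parks-once c cs {occ} {k = k} c∉cs u≢k free-u run occF-k occF-u = All.lookup c∉cs c∈cs refl
      where
      d≡c = just-injective (trans (sym occF-k) (run-keeps cs (lookup∘update k occ (just c)) run))
      c∈cs = subst (_∈ cs) d≡c (run-fills cs (trans (lookup∘update′ u≢k occ (just c)) free-u) run occF-u)

    run-injective : ∀ cs {occ occF s t d} → Unique cs → lookup occ s ≡ nothing → lookup occ t ≡ nothing →
      runParking f cs occ ≡ just occF → lookup occF s ≡ just d → lookup occF t ≡ just d → s ≡ t
    run-injective []       _ free-s _ refl occF-s _ = ⊥-elim (free≢parked free-s occF-s)
    run-injective (c ∷ cs) {occ} {s = s} {t} (c∉cs ∷ unique) free-s free-t run occF-s occF-t
      with firstFreeFrom occ (lookup f c)
    ... | just k with s F.≟ k | t F.≟ k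
    ...   | yes s≡k  | yes t≡k  = trans s≡k (sym t≡k)
    ...   | yes refl | no t≢k   = ⊥-elim (run-parks-once c cs c∉cs t≢k free-t run occF-s occF-t)
    ...   | no s≢k   | yes refl = ⊥-elim (run-parks-once c cs c∉cs s≢k free-s run occF-t occF-s)
    ...   | no s≢k   | no t≢k   = run-injective cs unique (trans (lookup∘update′ s≢k occ _) free-s)
                                    (trans (lookup∘update′ t≢k occ _) free-t) run occF-s occF-t

  -- Pattern avoidance

  any-subseqs-true : ∀ {m} (g : Vec A m → Bool) {w} xs → toList w ⊆ xs → g w ≡ true →
    any g (subseqs m xs) ≡ true
  any-subseqs-true {m = zero}  g {[]}    xs       _             gw rewrite gw = refl
  any-subseqs-true {m = suc m} g {_ ∷ _} []       ()            _
  any-subseqs-true {m = suc m} g {_ ∷ _} (x ∷ xs) (.x ∷ʳ w⊆xs)  gw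
    rewrite any-++ g (map (x ∷_) (subseqs m xs)) (subseqs (suc m) xs) | any-subseqs-true g xs w⊆xs gw = ∨-zeroʳ _
  any-subseqs-true {m = suc m} g {_ ∷ w} (x ∷ xs) (refl ∷ w⊆xs) gw
    rewrite any-++ g (map (x ∷_) (subseqs m xs)) (subseqs (suc m) xs) | any-map g (x ∷_) (subseqs m xs)
          | any-subseqs-true (g ∘ (x ∷_)) xs w⊆xs gw = refl

  any-subseqs-false : ∀ {m} (g : Vec A m → Bool) xs → (∀ w → toList w ⊆ xs → g w ≡ false) →
    any g (subseqs m xs) ≡ false
  any-subseqs-false {m = zero}  g xs       none rewrite none [] (minimum xs) = refl
  any-subseqs-false {m = suc m} g []       none = refl
  any-subseqs-false {m = suc m} g (x ∷ xs) none
    rewrite any-++ g (map (x ∷_) (subseqs m xs)) (subseqs (suc m) xs) | any-map g (x ∷_) (subseqs m xs)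
          | any-subseqs-false (g ∘ (x ∷_)) xs (λ w w⊆xs → none (x ∷ w) (refl ∷ w⊆xs))
          | any-subseqs-false g xs (λ w w⊆xs → none w (x ∷ʳ w⊆xs)) = refl

  -- Abstracting the comparison of w a and w b makes the comparison function local to orderIso compute in agree.
  orderIso-< : ∀ {n m} {w : Vec (Fin n) m} {σ} → orderIso w σ ≡ true →
    ∀ a b → lookup σ a F.< lookup σ b → lookup w a F.< lookup w b
  orderIso-< {w = w} {σ} iso a b σa<σb
    with toℕ (lookup w a) <ᵇ toℕ (lookup w b) in wa<wb | all-∈ _ (all-∈ _ iso (∈-allFin a)) (∈-allFin b)
  ... | true  | _     = <ᵇ-sound wa<wb
  ... | false | agree = contradiction (trans (sym agree) (cong not (<ᵇ-true σa<σb))) λ ()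

  orderIso-patterns : ∀ {n} {a b c : Fin n} → a F.< b → b F.< c →
    orderIso (a ∷ b ∷ c ∷ []) p123 ≡ true × orderIso (a ∷ c ∷ b ∷ []) p132 ≡ true ×
    orderIso (b ∷ a ∷ c ∷ []) p213 ≡ true
  orderIso-patterns {a = a} {b} {c} a<b b<c
    rewrite <ᵇ-true a<b | <ᵇ-true b<c | <ᵇ-true (<-trans a<b b<c)
          | <ᵇ-false (toℕ b) (toℕ a) (<⇒≤ a<b) | <ᵇ-false (toℕ c) (toℕ b) (<⇒≤ b<c)
          | <ᵇ-false (toℕ c) (toℕ a) (<⇒≤ (<-trans a<b b<c))
          | <ᵇ-false (toℕ a) (toℕ a) ≤-refl | <ᵇ-false (toℕ b) (toℕ b) ≤-refl | <ᵇ-false (toℕ c) (toℕ c) ≤-refl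
          = refl , refl , refl

  -- The permutations avoiding 123, 132 and 213 are those in which every entry exceeds all entries at least
  -- two places to its right.
  Spread : ∀ {n} → List (Fin n) → Set
  Spread (x ∷ y ∷ zs) = All (F._< x) zs × Spread (y ∷ zs)
  Spread _            = ⊤

  spread-⊆ : ∀ {n} {xs : List (Fin n)} {a b c} → Spread xs → a ∷ b ∷ c ∷ [] ⊆ xs → c F.< a
  spread-⊆ {xs = x ∷ y ∷ zs} (_ , spread) (.x ∷ʳ abc⊆) = spread-⊆ spread abc⊆
  spread-⊆ {xs = x ∷ y ∷ zs} (beyond , _) (refl ∷ bc⊆) = All.lookup beyond (Sublist.lookup (∷⁻ bc⊆) (here refl))
  spread-⊆ {xs = x ∷ []}     _            (.x ∷ʳ ())
  spread-⊆ {xs = x ∷ []}     _            (refl ∷ ())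

  All-toList : ∀ {k} {Q : A → Set} (v : Vec A k) → (∀ i → Q (lookup v i)) → All Q (toList v)
  All-toList []      _ = []
  All-toList (x ∷ v) q = q F.zero ∷ All-toList v (q ∘ F.suc)

  spread-toList : ∀ {n k} (v : Vec (Fin n) k) → (∀ s t → 2 + toℕ s ≤ toℕ t → lookup v t F.< lookup v s) →
    Spread (toList v)
  spread-toList []          _      = tt
  spread-toList (x ∷ [])    _      = tt
  spread-toList (x ∷ y ∷ v) spread =
    All-toList v (λ t → spread F.zero (F.suc (F.suc t)) (s≤s (s≤s z≤n))) ,
    spread-toList (y ∷ v) (λ s t 2+s≤t → spread (F.suc s) (F.suc t) (s≤s 2+s≤t))

  ⊆-lookup₁ : ∀ {k} (v : Vec A k) i → lookup v i ∷ [] ⊆ toList v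
  ⊆-lookup₁ (x ∷ v) F.zero    = refl ∷ minimum _
  ⊆-lookup₁ (x ∷ v) (F.suc i) = x ∷ʳ ⊆-lookup₁ v i

  ⊆-lookup₂ : ∀ {k} (v : Vec A k) i j → i F.< j → lookup v i ∷ lookup v j ∷ [] ⊆ toList v
  ⊆-lookup₂ (x ∷ v) F.zero    (F.suc j) _         = refl ∷ ⊆-lookup₁ v j
  ⊆-lookup₂ (x ∷ v) (F.suc i) (F.suc j) (s≤s i<j) = x ∷ʳ ⊆-lookup₂ v i j i<j

  ⊆-lookup₃ : ∀ {k} (v : Vec A k) i j l → i F.< j → j F.< l → lookup v i ∷ lookup v j ∷ lookup v l ∷ [] ⊆ toList v
  ⊆-lookup₃ (x ∷ v) F.zero    (F.suc j) (F.suc l) _         (s≤s j<l) = refl ∷ ⊆-lookup₂ v j l j<l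
  ⊆-lookup₃ (x ∷ v) (F.suc i) (F.suc j) (F.suc l) (s≤s i<j) (s≤s j<l) = x ∷ʳ ⊆-lookup₃ v i j l i<j j<l

  σs : List (Vec (Fin 3) 3)
  σs = p123 ∷ p132 ∷ p213 ∷ []

  first<last : ∀ {σ} → σ ∈ σs → lookup σ F.zero F.< lookup σ (F.suc (F.suc F.zero))
  first<last (here refl)                 = s≤s z≤n
  first<last (there (here refl))         = s≤s z≤n
  first<last (there (there (here refl))) = s≤s (s≤s z≤n)

  avoidsAll-true : ∀ {n} (ρ : Vec (Fin n) n) → Spread (toList ρ) → avoidsAll ρ σs ≡ true
  avoidsAll-true ρ spread =
    all-true (avoids ρ) σs λ {σ} σ∈ → cong not (any-subseqs-false (λ w → orderIso w σ) (toList ρ) (noCopy σ∈))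
    where
    noCopy : ∀ {σ} → σ ∈ σs → ∀ w → toList w ⊆ toList ρ → orderIso w σ ≡ false
    noCopy {σ} σ∈ (a ∷ b ∷ c ∷ []) abc⊆ = ¬-not λ iso → <-asym (spread-⊆ spread abc⊆)
      (orderIso-< {w = a ∷ b ∷ c ∷ []} {σ} iso F.zero (F.suc (F.suc F.zero)) (first<last σ∈))

  avoidsAll-occurrence : ∀ {n} (ρ : Vec (Fin n) n) {i j k σ} → i F.< j → j F.< k → σ ∈ σs →
    orderIso (lookup ρ i ∷ lookup ρ j ∷ lookup ρ k ∷ []) σ ≡ true → avoidsAll ρ σs ≡ false
  avoidsAll-occurrence ρ {i} {j} {k} {σ} i<j j<k σ∈ iso =
    all-false (avoids ρ) σ∈
      (cong not (any-subseqs-true (λ w → orderIso w σ) (toList ρ) (⊆-lookup₃ ρ i j k i<j j<k) iso))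

  avoidsAll-false : ∀ {n} (ρ : Vec (Fin n) n) {i j k} → i F.< j → j F.< k → lookup ρ i F.< lookup ρ k →
    lookup ρ j ≢ lookup ρ i → lookup ρ j ≢ lookup ρ k → avoidsAll ρ σs ≡ false
  avoidsAll-false ρ {i} {j} {k} i<j j<k x<z y≢x y≢z
    with FP.<-cmp (lookup ρ j) (lookup ρ i) | FP.<-cmp (lookup ρ j) (lookup ρ k)
  ... | tri≈ _ y≡x _ | _            = contradiction y≡x y≢x
  ... | _            | tri≈ _ y≡z _ = contradiction y≡z y≢z
  ... | tri< y<x _ _ | _            =
    avoidsAll-occurrence ρ i<j j<k (there (there (here refl))) (proj₂ (proj₂ (orderIso-patterns y<x x<z)))
  ... | tri> _ _ x<y | tri< y<z _ _ =
    avoidsAll-occurrence ρ i<j j<k (here refl) (proj₁ (orderIso-patterns x<y y<z))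
  ... | tri> _ _ x<y | tri> _ _ z<y =
    avoidsAll-occurrence ρ i<j j<k (there (here refl)) (proj₁ (proj₂ (orderIso-patterns x<z z<y)))

  -- Admissible preference lists

  -- With the spots 0, …, m-1 free, the cars fill them from the right: either one car prefers m-1,
  -- or two cars take m-2 and m-1, preferring m-2 and then m-2 or m-1.
  admissible fillsOne fillsTwo : ℕ → List ℕ → Bool
  admissible zero    []      = true
  admissible zero    (_ ∷ _) = false
  admissible (suc m) ps      = fillsOne (suc m) ps ∨ fillsTwo (suc m) ps
  fillsOne (suc m) (p ∷ ps)           = (p ≡ᵇ m) ∧ admissible m ps
  fillsOne _       _                  = false
  fillsTwo (suc (suc m)) (p ∷ q ∷ ps) = (p ≡ᵇ m) ∧ (((q ≡ᵇ m) ∨ (q ≡ᵇ suc m)) ∧ admissible m ps)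
  fillsTwo _             _            = false

  data Admissible : ℕ → List ℕ → Set where
    []  : Admissible 0 []
    one : ∀ {m ps} → Admissible m ps → Admissible (suc m) (m ∷ ps)
    two : ∀ {m q ps} → q ≡ m ⊎ q ≡ suc m → Admissible m ps → Admissible (suc (suc m)) (m ∷ q ∷ ps)

  admissible-sound : ∀ m ps → admissible m ps ≡ true → Admissible m ps
  fillsOne-sound : ∀ m ps → fillsOne (suc m) ps ≡ true → Admissible (suc m) ps
  fillsTwo-sound : ∀ m ps → fillsTwo (suc (suc m)) ps ≡ true → Admissible (suc (suc m)) ps

  admissible-sound zero          []  _ = []
  admissible-sound (suc m)       ps  e with ∨-true {fillsOne (suc m) ps} e
  admissible-sound (suc m)       ps  _ | inj₁ e = fillsOne-sound m ps e
  admissible-sound (suc zero)    ps  _ | inj₂ ()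
  admissible-sound (suc (suc m)) ps  _ | inj₂ e = fillsTwo-sound m ps e

  fillsOne-sound m (p ∷ ps) e with ∧-true {p ≡ᵇ m} e
  ... | p≡m , rest with ≡ᵇ-sound {p} {m} p≡m
  ...   | refl = one (admissible-sound m ps rest)

  fillsTwo-sound m (p ∷ q ∷ ps) e with ∧-true {p ≡ᵇ m} e
  ... | p≡m , rest with ∧-true {(q ≡ᵇ m) ∨ (q ≡ᵇ suc m)} rest | ≡ᵇ-sound {p} {m} p≡m
  ...   | q-ok , rest′ | refl = two (Sum.map ≡ᵇ-sound ≡ᵇ-sound (∨-true q-ok)) (admissible-sound m ps rest′)

  admissible-complete : ∀ {m ps} → Admissible m ps → admissible m ps ≡ true
  admissible-complete []                      = refl
  admissible-complete (one {m} a)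
    rewrite ≡ᵇ-refl m | admissible-complete a = refl
  admissible-complete (two {m} (inj₁ refl) a)
    rewrite ≡ᵇ-refl m | admissible-complete a = ∨-zeroʳ _
  admissible-complete (two {m} (inj₂ refl) a)
    rewrite ≡ᵇ-refl m | admissible-complete a | ∨-zeroʳ (suc m ≡ᵇ m) = ∨-zeroʳ _

  admissible-one : ∀ m ps → admissible (suc m) (m ∷ ps) ≡ admissible m ps
  admissible-one m ps =
    ⇔→≡ (mk⇔ (λ e → fromOne (admissible-sound _ _ e)) (admissible-complete ∘ one ∘ admissible-sound m ps))
    where
    fromOne : Admissible (suc m) (m ∷ ps) → admissible m ps ≡ true
    fromOne (one a) = admissible-complete a

  admissible-two : ∀ {m q} ps → q ≡ m ⊎ q ≡ suc m → admissible (suc (suc m)) (m ∷ q ∷ ps) ≡ admissible m ps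
  admissible-two {m} {q} ps q-ok =
    ⇔→≡ (mk⇔ (λ e → fromTwo (admissible-sound _ _ e)) (admissible-complete ∘ two q-ok ∘ admissible-sound m ps))
    where
    fromTwo : Admissible (suc (suc m)) (m ∷ q ∷ ps) → admissible m ps ≡ true
    fromTwo (two _ a) = admissible-complete a

  admissible-head : ∀ {m p ps} → admissible (suc m) (p ∷ ps) ≡ true → p ≤ m × m ≤ suc p
  admissible-head {m} {p} {ps} e with admissible-sound (suc m) (p ∷ ps) e
  ... | one _   = ≤-refl , n≤1+n m
  ... | two _ _ = n≤1+n p , ≤-refl

  admissible-second : ∀ {m q ps} → admissible (suc (suc m)) (m ∷ q ∷ ps) ≡ true → m ≤ q × q ≤ suc m
  admissible-second {m} {q} {ps} e with admissible-sound (suc (suc m)) (m ∷ q ∷ ps) e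
  ... | two (inj₁ refl) _ = ≤-refl , n≤1+n m
  ... | two (inj₂ refl) _ = n≤1+n m , ≤-refl

  prefix-one : ∀ {m ps i} → suc i ⊓ m ≤ count (_≤ᵇ i) ps → suc i ⊓ suc m ≤ count (_≤ᵇ i) (m ∷ ps)
  prefix-one {m} {ps} {i} bound with m ≤? i
  ... | yes m≤i rewrite ≤ᵇ-true m≤i = s≤s (≤-trans (⊓-monoˡ-≤ m (n≤1+n i)) bound)
  ... | no m≰i = begin
    suc (i ⊓ m)             ≤⟨ s≤s (m⊓n≤m i m) ⟩
    suc i                   ≤⟨ ⊓-glb ≤-refl (≰⇒> m≰i) ⟩
    suc i ⊓ m               ≤⟨ bound ⟩
    count (_≤ᵇ i) ps        ≤⟨ count-∷-≤ (_≤ᵇ i) m ps ⟩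
    count (_≤ᵇ i) (m ∷ ps)  ∎
    where open ≤-Reasoning

  prefix-two : ∀ {m q ps i} → q ≤ suc m → suc i ⊓ m ≤ count (_≤ᵇ i) ps →
    suc i ⊓ suc (suc m) ≤ count (_≤ᵇ i) (m ∷ q ∷ ps)
  prefix-two {m} {q} {ps} {i} q≤1+m bound with m ≤? i | q ≤? i
  ... | yes m≤i | yes q≤i rewrite ≤ᵇ-true m≤i | ≤ᵇ-true q≤i =
    s≤s (≤-trans (⊓-monoˡ-≤ (suc m) (n≤1+n i)) (s≤s (≤-trans (⊓-monoˡ-≤ m (n≤1+n i)) bound)))
  ... | yes m≤i | no q≰i rewrite ≤ᵇ-true m≤i = s≤s (begin
    i ⊓ suc m               ≤⟨ m⊓n≤m i (suc m) ⟩
    i                       ≤⟨ ⊓-glb (n≤1+n i) (≤-pred (≤-trans (≰⇒> q≰i) q≤1+m)) ⟩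
    suc i ⊓ m               ≤⟨ bound ⟩
    count (_≤ᵇ i) ps        ≤⟨ count-∷-≤ (_≤ᵇ i) q ps ⟩
    count (_≤ᵇ i) (q ∷ ps)  ∎)
    where open ≤-Reasoning
  ... | no m≰i | _ = begin
    suc (i ⊓ suc m)             ≤⟨ s≤s (m⊓n≤m i (suc m)) ⟩
    suc i                       ≤⟨ ⊓-glb ≤-refl (≰⇒> m≰i) ⟩
    suc i ⊓ m                   ≤⟨ bound ⟩
    count (_≤ᵇ i) ps            ≤⟨ count-∷-≤ (_≤ᵇ i) q ps ⟩
    count (_≤ᵇ i) (q ∷ ps)      ≤⟨ count-∷-≤ (_≤ᵇ i) m (q ∷ ps) ⟩
    count (_≤ᵇ i) (m ∷ q ∷ ps)  ∎
    where open ≤-Reasoning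

  -- Truncating at m turns the parking-function inequality into one that holds along Admissible.
  admissible-prefix : ∀ {m ps} → Admissible m ps → ∀ i → suc i ⊓ m ≤ count (_≤ᵇ i) ps
  admissible-prefix []                     i = z≤n
  admissible-prefix (one {ps = ps} a)      i = prefix-one {ps = ps} (admissible-prefix a i)
  admissible-prefix (two {ps = ps} q-ok a) i =
    prefix-two {ps = ps} (Sum.[ m≤n⇒m≤1+n ∘ ≤-reflexive , ≤-reflexive ] q-ok) (admissible-prefix a i)

  -- Simulating the parking process

  record Stage {n} (m : ℕ) (occ : Occupancy n) (cs : List (Fin n)) : Set where
    field
      waiting     : length cs ≡ m
      m≤n         : m ≤ n
      freeBelow   : ∀ s → toℕ s < m → lookup occ s ≡ nothing
      fullAbove   : ∀ s → m ≤ toℕ s → Occupied occ s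
      parkedFirst : ∀ {s d} → lookup occ s ≡ just d → All (d F.<_) cs
      spread      : ∀ {s t d e} → 2 + toℕ s ≤ toℕ t → lookup occ s ≡ just d → lookup occ t ≡ just e → e F.< d
      ascending   : AllPairs F._<_ cs
  open Stage

  stage₀ : ∀ {n} → Stage n (replicate n nothing) (allFin n)
  stage₀ {n} = record
    { waiting     = length-tabulate (λ x → x)
    ; m≤n         = ≤-refl
    ; freeBelow   = λ s _ → lookup-replicate s nothing
    ; fullAbove   = λ s n≤s → contradiction (toℕ<n s) (≤⇒≯ n≤s)
    ; parkedFirst = λ {s} → ⊥-elim ∘ free≢parked (lookup-replicate s nothing)
    ; spread      = λ {s} _ → ⊥-elim ∘ free≢parked (lookup-replicate s nothing)
    ; ascending   = tabulate⁺-< (λ i<j → i<j)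
    }

  -- With at most two new spots no two of them are two apart, so spread survives.
  fill : ∀ {n m} {occ occ′ : Occupancy n} ds {cs} → length ds ≤ 2 → Stage (length ds + m) occ (ds ++ cs) →
    (∀ s → toℕ s < m ⊎ length ds + m ≤ toℕ s → lookup occ′ s ≡ lookup occ s) →
    (∀ s → m ≤ toℕ s → toℕ s < length ds + m → ∃[ d ] d ∈ ds × lookup occ′ s ≡ just d) →
    Stage m occ′ cs
  fill {m = m} {occ} {occ′} ds {cs} ds≤2 st outside inside = record
    { waiting     = +-cancelˡ-≡ (length ds) _ _ (trans (sym (length-++ ds)) (waiting st))
    ; m≤n         = ≤-trans (m≤n+m m (length ds)) (m≤n st)
    ; freeBelow   = λ s s<m → trans (outside s (inj₁ s<m)) (freeBelow st s (≤-trans s<m (m≤n+m m _)))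
    ; fullAbove   = full
    ; parkedFirst = parked
    ; spread      = spread′
    ; ascending   = AllPairs-++⁻ʳ ds (ascending st)
    }
    where
    j = length ds
    old : ∀ {s d} → j + m ≤ toℕ s → lookup occ′ s ≡ just d → lookup occ s ≡ just d
    old j+m≤s e = trans (sym (outside _ (inj₂ j+m≤s))) e
    unparked : ∀ {s d} → toℕ s < m → lookup occ′ s ≡ just d → ⊥
    unparked s<m = free≢parked (trans (outside _ (inj₁ s<m)) (freeBelow st _ (≤-trans s<m (m≤n+m m j))))
    full : ∀ s → m ≤ toℕ s → Occupied occ′ s
    full s m≤s with trisect {m} {j + m} (toℕ s)
    ... | inj₁ s<m                = contradiction m≤s (<⇒≱ s<m)
    ... | inj₂ (inj₁ (_ , s<j+m)) = let d , _ , e = inside s m≤s s<j+m in d , e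
    ... | inj₂ (inj₂ j+m≤s)       = let d , e = fullAbove st s j+m≤s in d , trans (outside s (inj₂ j+m≤s)) e
    parked : ∀ {s d} → lookup occ′ s ≡ just d → All (d F.<_) cs
    parked {s} e with trisect {m} {j + m} (toℕ s)
    ... | inj₁ s<m = ⊥-elim (unparked s<m e)
    ... | inj₂ (inj₁ (m≤s , s<j+m)) with inside s m≤s s<j+m
    ...   | d , d∈ds , e′ rewrite just-injective (trans (sym e) e′) = AllPairs-++-∈ d∈ds (ascending st)
    parked {s} e | inj₂ (inj₂ j+m≤s) = ++⁻ʳ ds (parkedFirst st (old j+m≤s e))
    spread′ : ∀ {s t d e} → 2 + toℕ s ≤ toℕ t → lookup occ′ s ≡ just d → lookup occ′ t ≡ just e → e F.< d
    spread′ {s} {t} 2+s≤t es et with trisect {m} {j + m} (toℕ s) | trisect {m} {j + m} (toℕ t)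
    ... | inj₁ s<m | _        = ⊥-elim (unparked s<m es)
    ... | _        | inj₁ t<m = ⊥-elim (unparked t<m et)
    ... | _        | inj₂ (inj₁ (_ , t<j+m)) =
      ⊥-elim (unparked (+-cancelˡ-< 2 _ _ (<-≤-trans (≤-<-trans 2+s≤t t<j+m) (+-monoˡ-≤ m ds≤2))) es)
    ... | inj₂ (inj₁ (m≤s , s<j+m)) | inj₂ (inj₂ j+m≤t) with inside s m≤s s<j+m
    ...   | d , d∈ds , e′ rewrite just-injective (trans (sym es) e′) =
      All.lookup (++⁻ˡ ds (parkedFirst st (old j+m≤t et))) d∈ds
    spread′ 2+s≤t es et | inj₂ (inj₂ j+m≤s) | inj₂ (inj₂ j+m≤t) = spread st 2+s≤t (old j+m≤s es) (old j+m≤t et)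

  toℕs : ∀ {n k} → Vec (Fin n) k → List ℕ
  toℕs v = toList (V.map toℕ v)

  map-lookup-allFin : ∀ {n k} (v : Vec (Fin n) k) → map (toℕ ∘ lookup v) (allFin k) ≡ toℕs v
  map-lookup-allFin v = trans (map-tabulate (λ x → x) (toℕ ∘ lookup v)) (tabulate-lookup v)
    where
    tabulate-lookup : ∀ {n k} (v : Vec (Fin n) k) → tabulate (toℕ ∘ lookup v) ≡ toℕs v
    tabulate-lookup []      = refl
    tabulate-lookup (x ∷ v) = cong (toℕ x ∷_) (tabulate-lookup v)

  module Simulation {n} (f : Vec (Fin n) n) where

    pref : Fin n → ℕ
    pref c = toℕ (lookup f c)

    outcome : Maybe (Occupancy n) → Bool
    outcome nothing    = false
    outcome (just occ) = maybe (λ ρ → avoidsAll ρ σs) false (allJust occ)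

    parkPermAvoids≡outcome : parkPermAvoids f σs ≡ outcome (runParking f (allFin n) (replicate n nothing))
    parkPermAvoids≡outcome with runParking f (allFin n) (replicate n nothing)
    ... | nothing  = refl
    ... | just occ with allJust occ
    ...   | nothing = refl
    ...   | just ρ  = refl

    record Yields (cs : List (Fin n)) (occ : Occupancy n) (ρ : Vec (Fin n) n) : Set where
      field
        {occF} : Occupancy n
        run    : runParking f cs occ ≡ just occF
        ρ-at   : ∀ s → lookup occF s ≡ just (lookup ρ s)

      keeps : ∀ {s d} → lookup occ s ≡ just d → lookup ρ s ≡ d
      keeps {s} occ-s = just-injective (trans (sym (ρ-at s)) (run-keeps f cs occ-s run))

      fills : ∀ {s} → lookup occ s ≡ nothing → lookup ρ s ∈ cs
      fills {s} free = run-fills f cs free run (ρ-at s)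

      injective : Unique cs → ∀ {s t} → lookup occ s ≡ nothing → lookup occ t ≡ nothing →
        lookup ρ s ≡ lookup ρ t → s ≡ t
      injective unique {s} {t} free-s free-t ρs≡ρt =
        run-injective f cs unique free-s free-t run (ρ-at s) (trans (ρ-at t) (cong just (sym ρs≡ρt)))

    outcome-false : ∀ {cs occ} → (∀ ρ → Yields cs occ ρ → avoidsAll ρ σs ≡ false) →
      outcome (runParking f cs occ) ≡ false
    outcome-false {cs} {occ} patternFound with runParking f cs occ in run
    ... | nothing   = refl
    ... | just occF with allJust occF in aj
    ...   | nothing = refl
    ...   | just ρ  = patternFound ρ (record { run = run ; ρ-at = allJust-lookup occF aj })

    finish : ∀ {occ} → Stage 0 occ [] → outcome (just occ) ≡ true
    finish {occ} st with allJust-complete occ (λ s → fullAbove st s z≤n)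
    ... | ρ , aj rewrite aj = avoidsAll-true ρ (spread-toList ρ λ s t 2+s≤t → spread st 2+s≤t (ρ-at s) (ρ-at t))
      where
      ρ-at = allJust-lookup occ aj

    stuck : ∀ {c cs occ} → (∀ k → pref c ≤ toℕ k → Occupied occ k) → outcome (runParking f (c ∷ cs) occ) ≡ false
    stuck {c} {cs} {occ} full = cong outcome (run-stuck f c cs occ (firstFreeFrom-nothing occ _ full))

    single-step : ∀ {m occ c cs} → Stage (suc m) occ (c ∷ cs) → pref c ≡ m →
      ∃[ occ′ ] Stage m occ′ cs × runParking f (c ∷ cs) occ ≡ runParking f cs occ′
    single-step {m} {occ} {c} {cs} st p≡m =
      occ [ k ]≔ just c , fill (c ∷ []) (s≤s z≤n) st outside inside ,
      run-step f c cs occ (firstFreeFrom-self occ k free)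
      where
      k = lookup f c
      free : lookup occ k ≡ nothing
      free = freeBelow st k (s≤s (≤-reflexive p≡m))
      outside : ∀ s → toℕ s < m ⊎ suc m ≤ toℕ s → lookup (occ [ k ]≔ just c) s ≡ lookup occ s
      outside s out = lookup-elsewhere occ _ λ s≡k → ≢-outside ≤-refl ≤-refl out (trans s≡k p≡m)
      inside : ∀ s → m ≤ toℕ s → toℕ s < suc m → ∃[ d ] d ∈ c ∷ [] × lookup (occ [ k ]≔ just c) s ≡ just d
      inside s m≤s s<1+m rewrite toℕ-injective {i = s} {k} (trans (≤-antisym (≤-pred s<1+m) m≤s) (sym p≡m)) =
        c , here refl , lookup∘update k occ (just c)

    module FirstAtM {m occ c c₂ cs} (st : Stage (suc (suc m)) occ (c ∷ c₂ ∷ cs)) (p≡m : pref c ≡ m) where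

      k₀ k₁ : Fin n
      k₀ = lookup f c
      k₁ = fromℕ< (m≤n st)

      tk₁ : toℕ k₁ ≡ suc m
      tk₁ = toℕ-fromℕ< (m≤n st)

      k₀<k₁ : k₀ F.< k₁
      k₀<k₁ = subst₂ _<_ (sym p≡m) (sym tk₁) (n<1+n m)

      occ₁ : Occupancy n
      occ₁ = occ [ k₀ ]≔ just c

      first-parks : runParking f (c ∷ c₂ ∷ cs) occ ≡ runParking f (c₂ ∷ cs) occ₁
      first-parks =
        run-step f c _ occ (firstFreeFrom-self occ k₀ (freeBelow st k₀ (subst (_< 2 + m) (sym p≡m) (m<n+m m z<s))))

      elsewhere : ∀ s → toℕ s ≢ m → lookup occ₁ s ≡ lookup occ s
      elsewhere s s≢m = lookup-elsewhere occ _ (λ s≡k₀ → s≢m (trans s≡k₀ p≡m))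

      free₁ : lookup occ₁ k₁ ≡ nothing
      free₁ = trans (elsewhere k₁ (λ k₁≡m → 1+n≢n (trans (sym tk₁) k₁≡m))) (freeBelow st k₁ (s≤s (≤-reflexive tk₁)))

    pair-step : ∀ {m occ c c₂ cs} → Stage (suc (suc m)) occ (c ∷ c₂ ∷ cs) → pref c ≡ m →
      m ≤ pref c₂ → pref c₂ < 2 + m → ∃[ occ′ ] Stage m occ′ cs × runParking f (c ∷ c₂ ∷ cs) occ ≡ runParking f cs occ′
    pair-step {m} {occ} {c} {c₂} {cs} st p≡m m≤q q<2+m =
      occ₂ , fill (c ∷ c₂ ∷ []) ≤-refl st outside inside , trans first-parks (run-step f c₂ cs occ₁ second-parks)
      where
      open FirstAtM st p≡m
      occ₂ = occ₁ [ k₁ ]≔ just c₂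
      q≤k₁ : pref c₂ ≤ toℕ k₁
      q≤k₁ = subst (pref c₂ ≤_) (sym tk₁) (≤-pred q<2+m)
      second-parks : firstFreeFrom occ₁ (lookup f c₂) ≡ just k₁
      second-parks = firstFreeFrom-just occ₁ _ q≤k₁ free₁ λ j q≤j j<k₁ →
        let j≡m = ≤-antisym (≤-pred (subst (toℕ j <_) tk₁ j<k₁)) (≤-trans m≤q q≤j) in
        c , subst (λ s → lookup occ₁ s ≡ just c) (sym (toℕ-injective (trans j≡m (sym p≡m)))) (lookup∘update k₀ occ _)
      outside : ∀ s → toℕ s < m ⊎ 2 + m ≤ toℕ s → lookup occ₂ s ≡ lookup occ s
      outside s out = trans (lookup-elsewhere occ₁ _ λ s≡k₁ → ≢-outside (n≤1+n m) ≤-refl out (trans s≡k₁ tk₁))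
                            (elsewhere s (≢-outside ≤-refl (m<n+m m z<s) out))
      inside : ∀ s → m ≤ toℕ s → toℕ s < 2 + m → ∃[ d ] d ∈ c ∷ c₂ ∷ [] × lookup occ₂ s ≡ just d
      inside s m≤s s<2+m with m≤n<2+m⇒n≡m⊎n≡1+m m≤s s<2+m
      ... | inj₁ s≡m   rewrite toℕ-injective {i = s} {k₀} (trans s≡m (sym p≡m)) =
        c , here refl , trans (lookup-elsewhere occ₁ _ (<⇒≢ k₀<k₁)) (lookup∘update k₀ occ _)
      ... | inj₂ s≡1+m rewrite toℕ-injective {i = s} {k₁} (trans s≡1+m (sym tk₁)) =
        c₂ , there (here refl) , lookup∘update k₁ occ₁ _

    -- The first car parks left of spot m, so the cars later filling m and m+1 form a 123 or 132 with it.
    first-early : ∀ {m occ c c₂ cs} → Stage (suc (suc m)) occ (c ∷ c₂ ∷ cs) → pref c < m →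
      outcome (runParking f (c ∷ c₂ ∷ cs) occ) ≡ false
    first-early {m} {occ} {c} {c₂} {cs} st p<m =
      trans (cong outcome (run-step f c _ occ (firstFreeFrom-self occ k free))) (outcome-false patternFound)
      where
      k k₀ k₁ : Fin n
      k  = lookup f c
      k₀ = fromℕ< (<-trans (n<1+n m) (m≤n st))
      k₁ = fromℕ< (m≤n st)
      occ₁ = occ [ k ]≔ just c
      free : lookup occ k ≡ nothing
      free = freeBelow st k (<-trans p<m (m<n+m m z<s))
      free-late : ∀ s → m ≤ toℕ s → toℕ s < 2 + m → lookup occ₁ s ≡ nothing
      free-late s m≤s s<2+m =
        trans (lookup-elsewhere occ _ λ s≡p → <⇒≱ p<m (subst (m ≤_) s≡p m≤s)) (freeBelow st s s<2+m)
      free₀ = free-late k₀ (≤-reflexive (sym (toℕ-fromℕ< _))) (subst (_< 2 + m) (sym (toℕ-fromℕ< _)) (m<n+m m z<s))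
      free₁ = free-late k₁ (subst (m ≤_) (sym (toℕ-fromℕ< _)) (n≤1+n m)) (subst (_< 2 + m) (sym (toℕ-fromℕ< _)) ≤-refl)
      k<k₀ : k F.< k₀
      k<k₀ = subst (pref c <_) (sym (toℕ-fromℕ< _)) p<m
      k₀<k₁ : k₀ F.< k₁
      k₀<k₁ = subst₂ _<_ (sym (toℕ-fromℕ< _)) (sym (toℕ-fromℕ< _)) (n<1+n m)
      patternFound : ∀ ρ → Yields (c₂ ∷ cs) occ₁ ρ → avoidsAll ρ σs ≡ false
      patternFound ρ yields = avoidsAll-false ρ k<k₀ k₀<k₁ (subst (F._< lookup ρ k₁) (sym ρk≡c) (later free₁))
        (λ ρk₀≡ρk → <-irrefl (cong toℕ (trans (sym ρk≡c) (sym ρk₀≡ρk))) (later free₀))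
        (λ ρk₀≡ρk₁ → <⇒≢ k₀<k₁ (cong toℕ (injective unique free₀ free₁ ρk₀≡ρk₁)))
        where
        open Yields yields
        unique = ascending⇒unique (AllPairs.tail (ascending st))
        ρk≡c : lookup ρ k ≡ c
        ρk≡c = keeps (lookup∘update k occ (just c))
        later : ∀ {s} → lookup occ₁ s ≡ nothing → c F.< lookup ρ s
        later free-s = All.lookup (AllPairs.head (ascending st)) (fills free-s)

    -- The first car takes spot m and the second parks left of it; the car later filling m+1 completes a 213.
    second-early : ∀ {m occ c c₂ cs} → Stage (suc (suc m)) occ (c ∷ c₂ ∷ cs) → pref c ≡ m → pref c₂ < m →
      outcome (runParking f (c ∷ c₂ ∷ cs) occ) ≡ false
    second-early {m} {occ} {c} {c₂} {cs} st p≡m q<m =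
      trans (cong outcome (trans first-parks (run-step f c₂ cs occ₁ (firstFreeFrom-self occ₁ k₂ free₂))))
            (outcome-false {cs} {occ₂} patternFound)
      where
      open FirstAtM st p≡m
      k₂ = lookup f c₂
      occ₂ = occ₁ [ k₂ ]≔ just c₂
      k₂<k₀ : k₂ F.< k₀
      k₂<k₀ = subst (pref c₂ <_) (sym p≡m) q<m
      free₂ : lookup occ₁ k₂ ≡ nothing
      free₂ = trans (elsewhere k₂ (<⇒≢ q<m)) (freeBelow st k₂ (<-trans q<m (m<n+m m z<s)))
      c<c₂ : c F.< c₂
      c<c₂ = All.head (AllPairs.head (ascending st))
      patternFound : ∀ ρ → Yields cs occ₂ ρ → avoidsAll ρ σs ≡ false
      patternFound ρ yields = avoidsAll-false ρ k₂<k₀ k₀<k₁ (subst (F._< lookup ρ k₁) (sym ρk₂≡c₂) c₂<ρk₁)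
        (λ ρk₀≡ρk₂ → <⇒≢ c<c₂ (cong toℕ (trans (sym ρk₀≡c) (trans ρk₀≡ρk₂ ρk₂≡c₂))))
        (λ ρk₀≡ρk₁ → <⇒≢ (<-trans c<c₂ c₂<ρk₁) (cong toℕ (trans (sym ρk₀≡c) ρk₀≡ρk₁)))
        where
        open Yields yields
        ρk₀≡c : lookup ρ k₀ ≡ c
        ρk₀≡c = keeps (trans (lookup-elsewhere occ₁ _ (≢-sym (<⇒≢ k₂<k₀))) (lookup∘update k₀ occ _))
        ρk₂≡c₂ : lookup ρ k₂ ≡ c₂
        ρk₂≡c₂ = keeps (lookup∘update k₂ occ₁ _)
        c₂<ρk₁ : c₂ F.< lookup ρ k₁
        c₂<ρk₁ = All.lookup (AllPairs.head (AllPairs.tail (ascending st)))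
                            (fills (trans (lookup-elsewhere occ₁ _ (≢-sym (<⇒≢ (<-trans k₂<k₀ k₀<k₁)))) free₁))

    second-stuck : ∀ {m occ c c₂ cs} → Stage (suc (suc m)) occ (c ∷ c₂ ∷ cs) → pref c ≡ m → 2 + m ≤ pref c₂ →
      outcome (runParking f (c ∷ c₂ ∷ cs) occ) ≡ false
    second-stuck {m} {occ} {c} {c₂} st p≡m 2+m≤q = trans (cong outcome first-parks) (stuck full)
      where
      open FirstAtM st p≡m
      full : ∀ s → pref c₂ ≤ toℕ s → Occupied occ₁ s
      full s q≤s with fullAbove st s (≤-trans 2+m≤q q≤s)
      ... | d , occ-s = d , trans (elsewhere s λ s≡m → <⇒≱ (m<n+m m z<s) (subst (2 + m ≤_) s≡m (≤-trans 2+m≤q q≤s)))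
                                occ-s

    simulate : ∀ {m occ cs} → Stage m occ cs → outcome (runParking f cs occ) ≡ admissible m (map pref cs)
    simulate-pair : ∀ {m occ c cs} → Stage (suc m) occ (c ∷ cs) → pref c < m →
      outcome (runParking f (c ∷ cs) occ) ≡ admissible (suc m) (pref c ∷ map pref cs)

    simulate {zero}  {cs = []}    st = finish st
    simulate {zero}  {cs = _ ∷ _} st with () ← waiting st
    simulate {suc m} {cs = []}    st with () ← waiting st
    simulate {suc m} {occ} {c ∷ cs} st with <-cmp (pref c) m
    ... | tri< p<m _ _ = simulate-pair st p<m
    ... | tri> _ _ m<p =
      both-false (stuck λ s p≤s → fullAbove st s (≤-trans m<p p≤s)) (<⇒≱ m<p ∘ proj₁ ∘ admissible-head)
    ... | tri≈ _ p≡m _ with single-step st p≡m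
    ...   | occ′ , st′ , run≡ = begin
      outcome (runParking f (c ∷ cs) occ)        ≡⟨ cong outcome run≡ ⟩
      outcome (runParking f cs occ′)             ≡⟨ simulate st′ ⟩
      admissible m (map pref cs)                 ≡⟨ admissible-one m _ ⟨
      admissible (suc m) (m ∷ map pref cs)       ≡⟨ cong (λ p → admissible (suc m) (p ∷ map pref cs)) p≡m ⟨
      admissible (suc m) (pref c ∷ map pref cs)  ∎
      where open ≡-Reasoning

    simulate-pair {zero}  _                  ()
    simulate-pair {suc m} {cs = []}       st _ with () ← waiting st
    simulate-pair {suc m} {occ} {c} {c₂ ∷ cs} st p<1+m with <-cmp (pref c) m
    ... | tri> _ _ m<p = contradiction p<1+m (≤⇒≯ m<p)
    ... | tri< p<m _ _ = both-false (first-early st p<m) (<⇒≱ p<m ∘ ≤-pred ∘ proj₂ ∘ admissible-head)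
    ... | tri≈ _ p≡m _ rewrite p≡m with trisect {m} {2 + m} (pref c₂)
    ...   | inj₁ q<m          = both-false (second-early st p≡m q<m) (<⇒≱ q<m ∘ proj₁ ∘ admissible-second)
    ...   | inj₂ (inj₂ 2+m≤q) = both-false (second-stuck st p≡m 2+m≤q) (<⇒≱ 2+m≤q ∘ proj₂ ∘ admissible-second)
    ...   | inj₂ (inj₁ (m≤q , q<2+m)) with pair-step st p≡m m≤q q<2+m
    ...     | occ′ , st′ , run≡ = begin
      outcome (runParking f (c ∷ c₂ ∷ cs) occ)        ≡⟨ cong outcome run≡ ⟩
      outcome (runParking f cs occ′)                  ≡⟨ simulate st′ ⟩
      admissible m (map pref cs)                      ≡⟨ admissible-two _ (m≤n<2+m⇒n≡m⊎n≡1+m m≤q q<2+m) ⟨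
      admissible (2 + m) (m ∷ pref c₂ ∷ map pref cs)  ∎
      where open ≡-Reasoning

    parkPermAvoids≡admissible : parkPermAvoids f σs ≡ admissible n (toℕs f)
    parkPermAvoids≡admissible =
      trans parkPermAvoids≡outcome (trans (simulate stage₀) (cong (admissible n) (map-lookup-allFin f)))

    admissible⇒parkingFunction : admissible n (toℕs f) ≡ true → isParkingFunction f ≡ true
    admissible⇒parkingFunction adm = all-true _ (allFin n) λ {i} _ → ≤ᵇ-true (begin
      suc (toℕ i)                               ≡⟨ m≤n⇒m⊓n≡m (toℕ<n i) ⟨
      suc (toℕ i) ⊓ n                           ≤⟨ admissible-prefix (admissible-sound n _ adm) (toℕ i) ⟩
      count (_≤ᵇ toℕ i) (toℕs f)                ≡⟨ cong (count (_≤ᵇ toℕ i)) (map-lookup-allFin f) ⟨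
      count (_≤ᵇ toℕ i) (map pref (allFin n))   ≡⟨ count-map (_≤ᵇ toℕ i) pref (allFin n) ⟩
      count (λ j → pref j ≤ᵇ toℕ i) (allFin n)  ∎)
      where open ≤-Reasoning

    parkingAvoiding≡admissible : (isParkingFunction f ∧ parkPermAvoids f σs) ≡ admissible n (toℕs f)
    parkingAvoiding≡admissible rewrite parkPermAvoids≡admissible with admissible n (toℕs f) in adm
    ... | true  rewrite admissible⇒parkingFunction adm = refl
    ... | false = ∧-zeroʳ _

  -- Counting admissible preference lists

  ≡ᵇ-disjoint : ∀ a {m n} → m ≢ n → ∀ x y → ((a ≡ᵇ m) ∧ x) ∧ ((a ≡ᵇ n) ∧ y) ≡ false
  ≡ᵇ-disjoint a {m} {n} m≢n x y with a ≡ᵇ m in a≡m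
  ... | false = refl
  ... | true rewrite reflects-false (≡ᵇ-reflects-≡ a n) (m≢n ∘ trans (sym (≡ᵇ-sound a≡m))) = ∧-zeroʳ x

  fills-disjoint : ∀ m ps → fillsOne m ps ∧ fillsTwo m ps ≡ false
  fills-disjoint (suc (suc m)) (p ∷ q ∷ ps) = ≡ᵇ-disjoint p 1+n≢n (admissible (suc m) (q ∷ ps)) _
  fills-disjoint zero          _            = refl
  fills-disjoint (suc zero)    ps           = ∧-zeroʳ _
  fills-disjoint (suc (suc m)) []           = refl
  fills-disjoint (suc (suc m)) (p ∷ [])     = ∧-zeroʳ _

  jacobsthal : ℕ → ℕ
  jacobsthal 0             = 0
  jacobsthal 1             = 1
  jacobsthal (suc (suc n)) = jacobsthal (suc n) + 2 * jacobsthal n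

  module Counting (N : ℕ) where

    vecs : ∀ k → List (Vec (Fin N) k)
    vecs k = allVecs k (allFin N)

    vecCount : ∀ k → (List ℕ → Bool) → ℕ
    vecCount k p = count (p ∘ toℕs) (vecs k)

    admissibleCount : ℕ → ℕ
    admissibleCount m = vecCount m (admissible m)

    count-admissible-suc : ∀ m →
      admissibleCount (suc m) ≡ vecCount (suc m) (fillsOne (suc m)) + vecCount (suc m) (fillsTwo (suc m))
    count-admissible-suc m = count-∨ _ _ (fills-disjoint (suc m) ∘ toℕs) (vecs (suc m))

    count-fillsOne : ∀ m → m < N → vecCount (suc m) (fillsOne (suc m)) ≡ admissibleCount m
    count-fillsOne m m<N = trans (count-cong (λ { (x ∷ v) → refl }) (vecs (suc m))) (count-head m _ m<N)

    count-fillsTwo : ∀ m → suc m < N →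
      vecCount (suc (suc m)) (fillsTwo (suc (suc m))) ≡ admissibleCount m + admissibleCount m
    count-fillsTwo m 1+m<N = begin
      vecCount (suc (suc m)) (fillsTwo (suc (suc m)))
        ≡⟨ count-cong (λ { (x ∷ y ∷ v) → refl }) (vecs (suc (suc m))) ⟩
      count (λ v → (toℕ (V.head v) ≡ᵇ m) ∧ second (V.tail v)) (vecs (suc (suc m)))
        ≡⟨ count-head m second m<N ⟩
      count second (vecs (suc m))
        ≡⟨ count-cong (λ { (y ∷ v) → ∧-distribʳ-∨ _ (toℕ y ≡ᵇ m) _ }) (vecs (suc m)) ⟩
      count (λ v → headIs m v ∨ headIs (suc m) v) (vecs (suc m))
        ≡⟨ count-∨ (headIs m) (headIs (suc m)) (λ { (y ∷ v) → ≡ᵇ-disjoint (toℕ y) (≢-sym 1+n≢n) _ _ }) (vecs (suc m)) ⟩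
      count (headIs m) (vecs (suc m)) + count (headIs (suc m)) (vecs (suc m))
        ≡⟨ cong₂ _+_ (count-head m _ m<N) (count-head (suc m) _ 1+m<N) ⟩
      admissibleCount m + admissibleCount m ∎
      where
      open ≡-Reasoning
      m<N = <-trans (n<1+n m) 1+m<N
      second : Vec (Fin N) (suc m) → Bool
      second v = ((toℕ (V.head v) ≡ᵇ m) ∨ (toℕ (V.head v) ≡ᵇ suc m)) ∧ admissible m (toℕs (V.tail v))
      headIs : ℕ → Vec (Fin N) (suc m) → Bool
      headIs j v = (toℕ (V.head v) ≡ᵇ j) ∧ admissible m (toℕs (V.tail v))

    admissibleCount≡jacobsthal : ∀ m → m ≤ N → admissibleCount m ≡ jacobsthal (suc m)
    admissibleCount≡jacobsthal zero          _     = refl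
    admissibleCount≡jacobsthal (suc zero)    1≤N   = begin
      admissibleCount 1
        ≡⟨ count-admissible-suc 0 ⟩
      vecCount 1 (fillsOne 1) + vecCount 1 (fillsTwo 1)
        ≡⟨ cong₂ _+_ (count-fillsOne 0 1≤N) (count-false (vecs 1)) ⟩
      1 ∎
      where open ≡-Reasoning
    admissibleCount≡jacobsthal (suc (suc m)) 2+m≤N = begin
      admissibleCount (suc (suc m))
        ≡⟨ count-admissible-suc (suc m) ⟩
      vecCount (suc (suc m)) (fillsOne (suc (suc m))) + vecCount (suc (suc m)) (fillsTwo (suc (suc m)))
        ≡⟨ cong₂ _+_ (count-fillsOne (suc m) 2+m≤N) (count-fillsTwo m 2+m≤N) ⟩
      admissibleCount (suc m) + (admissibleCount m + admissibleCount m)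
        ≡⟨ cong₂ (λ a b → a + (b + b)) (admissibleCount≡jacobsthal (suc m) (<⇒≤ 2+m≤N))
                                      (admissibleCount≡jacobsthal m (<⇒≤ (<⇒≤ 2+m≤N))) ⟩
      jacobsthal (suc (suc m)) + (jacobsthal (suc m) + jacobsthal (suc m))
        ≡⟨ cong (λ b → jacobsthal (suc (suc m)) + (jacobsthal (suc m) + b)) (+-identityʳ _) ⟨
      jacobsthal (suc (suc (suc m))) ∎
      where open ≡-Reasoning

  pk≡jacobsthal : ∀ n → pk n σs ≡ jacobsthal (suc n)
  pk≡jacobsthal n = begin
    pk n σs                       ≡⟨ count-cong Simulation.parkingAvoiding≡admissible (allFunctions n) ⟩
    Counting.admissibleCount n n  ≡⟨ Counting.admissibleCount≡jacobsthal n n ≤-refl ⟩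
    jacobsthal (suc n)            ∎
    where open ≡-Reasoning

open Enumeration using (σs; jacobsthal; pk≡jacobsthal)
open import Data.Integer using (+_; -_; _+_; _*_; _-_; _^_)
open import Data.Integer.Properties using (pos-+; pos-*)
open import Data.Integer.Solver using (module +-*-Solver)

jacobsthal-closed : ∀ n → + 3 * + jacobsthal n ≡ (+ 2) ^ n - (- + 1) ^ n
jacobsthal-closed 0             = refl
jacobsthal-closed 1             = refl
jacobsthal-closed (suc (suc n)) = begin
  + 3 * + jacobsthal (suc (suc n))
    ≡⟨ cong (+ 3 *_) (trans (pos-+ a _) (cong (_+_ (+ a)) (pos-* 2 b))) ⟩
  + 3 * (+ a + + 2 * + b)
    ≡⟨ solve 2 (λ a b → con (+ 3) :* (a :+ con (+ 2) :* b) := con (+ 3) :* a :+ con (+ 2) :* (con (+ 3) :* b)) refl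
             (+ a) (+ b) ⟩
  + 3 * + a + + 2 * (+ 3 * + b)
    ≡⟨ cong₂ (λ u v → u + + 2 * v) (jacobsthal-closed (suc n)) (jacobsthal-closed n) ⟩
  (+ 2 * x - - + 1 * y) + + 2 * (x - y)
    ≡⟨ solve 2 (λ x y → (con (+ 2) :* x :- con (- + 1) :* y) :+ con (+ 2) :* (x :- y)
                       := con (+ 2) :* (con (+ 2) :* x) :- con (- + 1) :* (con (- + 1) :* y)) refl x y ⟩
  (+ 2) ^ suc (suc n) - (- + 1) ^ suc (suc n) ∎
  where
  open ≡-Reasoning
  open +-*-Solver
  a = jacobsthal (suc n)
  b = jacobsthal n
  x = (+ 2) ^ n
  y = (- + 1) ^ n

mainTheorem7 : (n : ℕ) → n ≥ 1 →
    + 3 * + (pk n (p123 ∷ p132 ∷ p213 ∷ [])) ≡ + 2 * (+ 2) ^ n + (- + 1) ^ n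
mainTheorem7 n _ = begin
  + 3 * + pk n σs             ≡⟨ cong (λ k → + 3 * + k) (pk≡jacobsthal n) ⟩
  + 3 * + jacobsthal (suc n)  ≡⟨ jacobsthal-closed (suc n) ⟩
  + 2 * x - - + 1 * y
    ≡⟨ solve 2 (λ x y → con (+ 2) :* x :- con (- + 1) :* y := con (+ 2) :* x :+ y) refl x y ⟩
  + 2 * x + y                 ∎
  where
  open ≡-Reasoning
  open +-*-Solver
  x = (+ 2) ^ n
  y = (- + 1) ^ n
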